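{- Let $f\ge0$ and $\tau\ge 1+f$. In the deterministic integral setting of edge-weighted online matching with buyback factor $f$, the deterministic algorithm with penalty scalar $\tau$ (described in the context) has competitive ratio at most $$\hat\Gamma_\tau(f)=\max_{w\ge\tau}\frac{(\tau+1)w-2\tau}{w-(1+f)}.$$
   Context: Edge-weighted online matching with buyback, deterministic integral setting: offline nodes $V$, each of capacity $1$, known upfront; online nodes $i=1,\dots,T$ arrive one at a time, each revealing nonnegative weights $w_{ij}$, $j\in V$. Upon arrival of $i$, a deterministic algorithm either leaves $i$ unmatched or matches it to one offline node $j$, in which case, if $j$ is currently matched to an earlier online node $i'$, that edge is bought back entirely: the reward $w_{i'j}$ is lost and an extra cost $f\,w_{i'j}$ is paid ($f\ge0$ the buyback factor); matching $i$ to $j$ yields reward $w_{ij}$. Profit = total reward of edges matched at the end minus total buyback costs. $\mathrm{OPT}(I)$ = maximum weight bipartite matching value of the instance; competitive ratio = $\sup_I\mathrm{OPT}(I)/\mathrm{ALG}(I)$. Algorithm with penalty scalar $\tau$: maintain $\underline w_j$ = weight of the edge currently matched at $j$ ($0$ if unmatched). For each arriving $i$: if some $j$ has $\tau\underline w_j<w_{ij}$, let $j^*\in\arg\max_j(w_{ij}-\tau\underline w_j)$, buy back $j^*$ from its current partner (if any), match $i$ to $j^*$ and set $\underline w_{j^*}\gets w_{ij^*}$; otherwise leave $i$ unmatched.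
   Formalization: The buyback factor f, the penalty scalar τ and all edge weights are taken in the rationals. -}

module Defs where

open import Data.Nat using (ℕ; zero; suc)
open import Data.Fin using (Fin; zero; suc)
open import Data.List using (List; []; _∷_; length; lookup)
open import Data.Maybe using (Maybe; just; nothing; maybe)
open import Data.Product using (_×_; Σ; _,_)
open import Data.Rational using (ℚ; 0ℚ; 1ℚ; _+_; _-_; _*_; _≤_; _<_)
open import Relation.Binary.PropositionalEquality using (_≡_; _≢_)

sumFin : {k : ℕ} → (Fin k → ℚ) → ℚ
sumFin {zero}  g = 0ℚ
sumFin {suc k} g = g zero + sumFin (λ i → g (suc i))

-- An online node (arrival) reveals weights to the n offline nodes.
Arrival : ℕ → Set
Arrival n = Fin n → ℚ

-- Algorithm state: lw j = weight of edge currently matched at j (0 if unmatched),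
-- together with the total buyback cost paid so far.
record State (n : ℕ) : Set where
  constructor st
  field
    lw   : Fin n → ℚ
    cost : ℚ

open State public

initState : (n : ℕ) → State n
initState n = st (λ _ → 0ℚ) 0ℚ

-- One step of the algorithm with penalty scalar τ and buyback factor f,
-- on arrival with weights w.  Ties in the argmax may be broken arbitrarily.
data Step {n : ℕ} (τ f : ℚ) (s : State n) (w : Arrival n) : State n → Set where
  leave : (∀ j → w j ≤ τ * lw s j) → Step τ f s w s
  match : (j : Fin n) (s' : State n) →
          τ * lw s j < w j →
          (∀ k → w k - τ * lw s k ≤ w j - τ * lw s j) →
          lw s' j ≡ w j →
          (∀ k → k ≢ j → lw s' k ≡ lw s k) →
          cost s' ≡ cost s + f * lw s j →
          Step τ f s w s'

data Run {n : ℕ} (τ f : ℚ) : State n → List (Arrival n) → State n → Set where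
  done : ∀ {s} → Run τ f s [] s
  step : ∀ {s s' s'' w ws} → Step τ f s w s' → Run τ f s' ws s'' → Run τ f s (w ∷ ws) s''

profit : {n : ℕ} → State n → ℚ
profit s = sumFin (lw s) - cost s

NonNegWeights : {n : ℕ} → List (Arrival n) → Set
NonNegWeights {n} ws = ∀ (i : Fin (length ws)) (j : Fin n) → 0ℚ ≤ lookup ws i j

record Matching {n : ℕ} (ws : List (Arrival n)) : Set where
  field
    assign    : Fin (length ws) → Maybe (Fin n)
    injective : ∀ i i' j → assign i ≡ just j → assign i' ≡ just j → i ≡ i'

open Matching public

matchingWeight : {n : ℕ} {ws : List (Arrival n)} → Matching ws → ℚ
matchingWeight {ws = ws} M = sumFin (λ i → maybe (lookup ws i) 0ℚ (assign M i))

-- c is an upper bound of Γ̂_τ(f) = sup_{w ≥ τ} ((τ+1)w - 2τ)/(w - (1+f)),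
-- (points with w = 1+f, a zero denominator, are excluded).
GammaUpperBound : (τ f c : ℚ) → Set
GammaUpperBound τ f c =
  ∀ (w : ℚ) → τ ≤ w → 1ℚ + f < w →
    (τ + 1ℚ) * w - (τ + τ) ≤ c * (w - (1ℚ + f))

-- Dual fitting.  Give offline node j the dual value τ · w̲_j, read off the final state, and
-- online node i the gain α_i = w_{ij*} − τ w̲_{j*} of its match (0 if it was left unmatched).
-- Greediness of the argmax gives w_{ij} ≤ α_i + τ w̲_j at the arrival of i, and w̲ only grows
-- (τ ≥ 1), so this is a feasible dual and OPT ≤ Σ α + τ Σ w̲ by weak duality.  A match that
-- replaces an edge of weight u by one of weight W raises the dual by (τ+1)W − 2τu and the
-- profit by W − (1+f)u; for u > 0 the ratio is the expression of Γ̂ at w = W/u, and for u = 0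
-- it is its limit τ + 1 as w → ∞.  Summing over the run, the dual is at most c · profit.
module Submission where

open import Defs
open import Data.Fin using (Fin; zero; suc; _≟_)
open import Data.Fin.Properties using (suc-injective; 0≢1+n)
open import Data.List using (List; length; lookup)
open import Data.Maybe using (Maybe; just; nothing; maybe; maybe′)
open import Data.Nat using (ℕ)
open import Data.Product using (Σ-syntax; _×_; _,_)
open import Data.Rational
  using (ℚ; 0ℚ; 1ℚ; _+_; _*_; _-_; -_; _≤_; _<_; _⊔_; 1/_; NonZero; Positive; positive; nonNegative)
open import Data.Rational.Properties hiding (_≟_)
open import Data.Rational.Solver using (module +-*-Solver)
import Data.Vec.Functional as Vector
open Vector using (tail; updateAt)
open import Data.Vec.Functional.Properties using (updateAt-updates; updateAt-minimal)
open import Relation.Binary.Definitions using (tri<; tri≈; tri>)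
open import Relation.Binary.PropositionalEquality
open import Relation.Nullary using (¬_; yes; no; contradiction)

open +-*-Solver using (solve; _:+_; _:-_; _:*_; _:=_; con)
open ≤-Reasoning

sumFin-cong : ∀ {k} {g h : Fin k → ℚ} → (∀ i → g i ≡ h i) → sumFin g ≡ sumFin h
sumFin-cong {ℕ.zero}  g≗h = refl
sumFin-cong {ℕ.suc k} g≗h = cong₂ _+_ (g≗h zero) (sumFin-cong (λ i → g≗h (suc i)))

sumFin-mono-≤ : ∀ {k} {g h : Fin k → ℚ} → (∀ i → g i ≤ h i) → sumFin g ≤ sumFin h
sumFin-mono-≤ {ℕ.zero}  g≤h = ≤-refl
sumFin-mono-≤ {ℕ.suc k} g≤h = +-mono-≤ (g≤h zero) (sumFin-mono-≤ (λ i → g≤h (suc i)))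

sumFin-zero : ∀ k → sumFin {k} (λ _ → 0ℚ) ≡ 0ℚ
sumFin-zero ℕ.zero    = refl
sumFin-zero (ℕ.suc k) = trans (+-identityˡ _) (sumFin-zero k)

sumFin-nonNeg : ∀ {k} {g : Fin k → ℚ} → (∀ i → 0ℚ ≤ g i) → 0ℚ ≤ sumFin g
sumFin-nonNeg {k} {g} 0≤g = subst (_≤ sumFin g) (sumFin-zero k) (sumFin-mono-≤ 0≤g)

sumFin-distrib-+ : ∀ {k} (g h : Fin k → ℚ) →
                   sumFin (λ i → g i + h i) ≡ sumFin g + sumFin h
sumFin-distrib-+ {ℕ.zero}  g h = refl
sumFin-distrib-+ {ℕ.suc k} g h =
  trans (cong (g zero + h zero +_) (sumFin-distrib-+ (tail g) (tail h)))
        (solve 4 (λ a b A B → (a :+ b) :+ (A :+ B) := (a :+ A) :+ (b :+ B)) refl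
           (g zero) (h zero) (sumFin (tail g)) (sumFin (tail h)))

sumFin-distribˡ-* : ∀ {k} (r : ℚ) (g : Fin k → ℚ) →
                    sumFin (λ i → r * g i) ≡ r * sumFin g
sumFin-distribˡ-* {ℕ.zero}  r g = sym (*-zeroʳ r)
sumFin-distribˡ-* {ℕ.suc k} r g =
  trans (cong (r * g zero +_) (sumFin-distribˡ-* r (tail g)))
        (sym (*-distribˡ-+ r (g zero) _))

sumFin-update : ∀ {k} (g g′ : Fin k → ℚ) (j : Fin k) → (∀ i → i ≢ j → g′ i ≡ g i) →
                sumFin g′ ≡ sumFin g + (g′ j - g j)
sumFin-update g g′ zero g′≗g =
  trans (cong (g′ zero +_) (sumFin-cong (λ i → g′≗g (suc i) (λ ()))))
        (solve 3 (λ a′ a S → a′ :+ S := (a :+ S) :+ (a′ :- a)) refl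
           (g′ zero) (g zero) (sumFin (tail g)))
sumFin-update g g′ (suc j) g′≗g =
  trans (cong₂ _+_ (g′≗g zero (λ ()))
          (sumFin-update (tail g) (tail g′) j
             (λ i i≢j → g′≗g (suc i) (λ si≡sj → i≢j (suc-injective si≡sj)))))
        (sym (+-assoc (g zero) _ _))

PartialInjective : ∀ {T k} → (Fin T → Maybe (Fin k)) → Set
PartialInjective a = ∀ i i′ j → a i ≡ just j → a i′ ≡ just j → i ≡ i′

tail-partialInjective : ∀ {T k} {a : Fin (ℕ.suc T) → Maybe (Fin k)} →
                        PartialInjective a → PartialInjective (tail a)
tail-partialInjective a-inj i i′ j ai≡ ai′≡ = suc-injective (a-inj (suc i) (suc i′) j ai≡ ai′≡)

erase : ∀ {k} → (Fin k → ℚ) → Fin k → Fin k → ℚ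
erase g j = updateAt g j (λ _ → 0ℚ)

erase-nonNeg : ∀ {k} {g : Fin k → ℚ} → (∀ i → 0ℚ ≤ g i) → ∀ j i → 0ℚ ≤ erase g j i
erase-nonNeg {g = g} 0≤g j i with i ≟ j
... | yes refl = ≤-reflexive (sym (updateAt-updates j g))
... | no i≢j   = subst (0ℚ ≤_) (sym (updateAt-minimal i j g i≢j)) (0≤g i)

sumFin-erase : ∀ {k} (g : Fin k → ℚ) j → g j + sumFin (erase g j) ≡ sumFin g
sumFin-erase g j = begin-equality
  g j + sumFin (erase g j)
    ≡⟨ cong (g j +_) (sumFin-update g (erase g j) j (λ i i≢j → updateAt-minimal i j g i≢j)) ⟩
  g j + (sumFin g + (erase g j j - g j))
    ≡⟨ cong (λ x → g j + (sumFin g + (x - g j))) (updateAt-updates j g) ⟩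
  g j + (sumFin g + (0ℚ - g j))
    ≡⟨ solve 2 (λ x S → x :+ (S :+ (con 0ℚ :- x)) := S) refl (g j) (sumFin g) ⟩
  sumFin g
    ∎

maybe-erase : ∀ {k} (g : Fin k → ℚ) j m → (∀ i → m ≡ just i → i ≢ j) →
              maybe′ (erase g j) 0ℚ m ≡ maybe′ g 0ℚ m
maybe-erase g j nothing  _        = refl
maybe-erase g j (just i) avoids-j = updateAt-minimal i j g (avoids-j i refl)

sumFin-maybe-injective-≤ : ∀ {T k} (a : Fin T → Maybe (Fin k)) → PartialInjective a →
  (g : Fin k → ℚ) → (∀ j → 0ℚ ≤ g j) → sumFin (λ i → maybe g 0ℚ (a i)) ≤ sumFin g
sumFin-maybe-injective-≤ {ℕ.zero} a a-inj g 0≤g = sumFin-nonNeg 0≤g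
sumFin-maybe-injective-≤ {ℕ.suc T} a a-inj g 0≤g with a zero in a0≡
... | nothing = begin
  0ℚ + sumFin (λ i → maybe g 0ℚ (a (suc i)))
    ≡⟨ +-identityˡ _ ⟩
  sumFin (λ i → maybe g 0ℚ (a (suc i)))
    ≤⟨ sumFin-maybe-injective-≤ (tail a) (tail-partialInjective a-inj) g 0≤g ⟩
  sumFin g
    ∎
... | just j = begin
  g j + sumFin (λ i → maybe g 0ℚ (a (suc i)))
    ≡⟨ cong (g j +_) (sumFin-cong (λ i → sym (maybe-erase g j (a (suc i)) (tail-avoids-j i)))) ⟩
  g j + sumFin (λ i → maybe (erase g j) 0ℚ (a (suc i)))
    ≤⟨ +-monoʳ-≤ (g j) (sumFin-maybe-injective-≤ (tail a) (tail-partialInjective a-inj)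
                          (erase g j) (erase-nonNeg 0≤g j)) ⟩
  g j + sumFin (erase g j)
    ≡⟨ sumFin-erase g j ⟩
  sumFin g
    ∎
  where
  tail-avoids-j : ∀ i k → a (suc i) ≡ just k → k ≢ j
  tail-avoids-j i k ai≡ k≡j = 0≢1+n (a-inj zero (suc i) j a0≡ (trans ai≡ (cong just k≡j)))

matchingWeight-≤-dual : ∀ {n} {ws : List (Arrival n)} (M : Matching ws)
  (α : Fin (length ws) → ℚ) (β : Fin n → ℚ) →
  (∀ i → 0ℚ ≤ α i) → (∀ j → 0ℚ ≤ β j) → (∀ i j → lookup ws i j ≤ α i + β j) →
  matchingWeight M ≤ sumFin α + sumFin β
matchingWeight-≤-dual {ws = ws} M α β 0≤α 0≤β covers = begin
  sumFin (λ i → maybe (lookup ws i) 0ℚ (assign M i))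
    ≤⟨ sumFin-mono-≤ (λ i → covered i (assign M i)) ⟩
  sumFin (λ i → α i + maybe β 0ℚ (assign M i))
    ≡⟨ sumFin-distrib-+ α (λ i → maybe β 0ℚ (assign M i)) ⟩
  sumFin α + sumFin (λ i → maybe β 0ℚ (assign M i))
    ≤⟨ +-monoʳ-≤ (sumFin α) (sumFin-maybe-injective-≤ (assign M) (injective M) β 0≤β) ⟩
  sumFin α + sumFin β
    ∎
  where
  covered : ∀ i m → maybe (lookup ws i) 0ℚ m ≤ α i + maybe β 0ℚ m
  covered i nothing  = subst (0ℚ ≤_) (sym (+-identityʳ (α i))) (0≤α i)
  covered i (just j) = covers i j

p<p+1 : ∀ p → p < p + 1ℚ
p<p+1 p = subst (_< p + 1ℚ) (+-identityʳ p) (+-monoʳ-< p (positive⁻¹ 1ℚ))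

p≤p+q : ∀ {p q} → 0ℚ ≤ q → p ≤ p + q
p≤p+q {p} {q} 0≤q = subst (_≤ p + q) (+-identityʳ p) (+-monoʳ-≤ p 0≤q)

0≤p*q : ∀ {p q} → 0ℚ ≤ p → 0ℚ ≤ q → 0ℚ ≤ p * q
0≤p*q {p} {q} 0≤p 0≤q =
  nonNegative⁻¹ (p * q) {{nonNeg*nonNeg⇒nonNeg p {{nonNegative 0≤p}} q {{nonNegative 0≤q}}}}

p<q⇒0<q-p : ∀ {p q} → p < q → 0ℚ < q - p
p<q⇒0<q-p {p} {q} p<q = subst (_< q - p) (+-inverseʳ p) (+-monoˡ-< (- p) p<q)

positive-slope-unbounded : ∀ {d t K} → 0ℚ < d → 0ℚ ≤ t → ¬ (∀ x → t < x → d * x ≤ K)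
positive-slope-unbounded {d} {t} {K} 0<d 0≤t bounded = <-irrefl refl (begin-strict
  K                              ≤⟨ p≤p⊔q K 0ℚ ⟩
  m                              ≡⟨ sym (+-identityˡ m) ⟩
  0ℚ + m                         <⟨ +-monoˡ-< m 0<d*[t+1] ⟩
  d * (t + 1ℚ) + m               ≡⟨ cong (λ z → d * (t + 1ℚ) + z) (sym (*-identityʳ m)) ⟩
  d * (t + 1ℚ) + m * 1ℚ          ≡⟨ cong (λ z → d * (t + 1ℚ) + m * z) (sym (*-inverseʳ d)) ⟩
  d * (t + 1ℚ) + m * (d * 1/ d)
    ≡⟨ solve 4 (λ d t+1 m i → d :* t+1 :+ m :* (d :* i) := d :* (t+1 :+ m :* i))
               refl d (t + 1ℚ) m (1/ d) ⟩
  d * x                          ≤⟨ bounded x t<x ⟩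
  K                              ∎)
  where
  instance
    d-pos : Positive d
    d-pos = positive 0<d
    d-nonZero : NonZero d
    d-nonZero = pos⇒nonZero d
  m = K ⊔ 0ℚ
  x = (t + 1ℚ) + m * 1/ d
  t<x : t < x
  t<x = <-≤-trans (p<p+1 t) (p≤p+q (0≤p*q (p≤q⊔p K 0ℚ) (<⇒≤ (positive⁻¹ (1/ d) {{1/pos⇒pos d}}))))
  0<d*[t+1] : 0ℚ < d * (t + 1ℚ)
  0<d*[t+1] = positive⁻¹ (d * (t + 1ℚ))
                {{pos*pos⇒pos d (t + 1ℚ) {{positive (≤-<-trans 0≤t (p<p+1 t))}}}}

GammaUpperBound⇒τ+1≤c : ∀ {τ f c} → 0ℚ ≤ τ → 1ℚ + f ≤ τ → GammaUpperBound τ f c → τ + 1ℚ ≤ c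
GammaUpperBound⇒τ+1≤c {τ} {f} {c} 0≤τ 1+f≤τ Γ with τ + 1ℚ ≤? c
... | yes τ+1≤c = τ+1≤c
... | no  τ+1≰c =
  contradiction slope-bounded (positive-slope-unbounded (p<q⇒0<q-p (≰⇒> τ+1≰c)) 0≤τ)
  where
  K = (τ + τ) - c * (1ℚ + f)
  slope-bounded : ∀ x → τ < x → (τ + 1ℚ - c) * x ≤ K
  slope-bounded x τ<x = begin
    (τ + 1ℚ - c) * x
      ≡⟨ solve 4 (λ τ f c x → ((τ :+ con 1ℚ) :- c) :* x
                    := ((τ :+ con 1ℚ) :* x :- (τ :+ τ))
                       :+ (((τ :+ τ) :- c :* (con 1ℚ :+ f)) :- c :* (x :- (con 1ℚ :+ f))))
                 refl τ f c x ⟩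
    ((τ + 1ℚ) * x - (τ + τ)) + (K - c * (x - (1ℚ + f)))
      ≤⟨ +-monoˡ-≤ _ (Γ x (<⇒≤ τ<x) (≤-<-trans 1+f≤τ τ<x)) ⟩
    c * (x - (1ℚ + f)) + (K - c * (x - (1ℚ + f)))
      ≡⟨ solve 2 (λ y K → y :+ (K :- y) := K) refl (c * (x - (1ℚ + f))) K ⟩
    K ∎

-- A match replacing an edge of weight u by one of weight W raises the dual objective by
-- (W − τu) + τ(W − u) and the profit by W − u − f u.
ReplacementBound : (τ f c : ℚ) → Set
ReplacementBound τ f c = ∀ {u W} → 0ℚ ≤ u → τ * u < W →
  (τ + 1ℚ) * W - (τ + τ) * u ≤ c * (W - (1ℚ + f) * u)

GammaUpperBound⇒ReplacementBound : ∀ {τ f c} → 0ℚ ≤ τ → 1ℚ + f ≤ τ →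
  GammaUpperBound τ f c → ReplacementBound τ f c
GammaUpperBound⇒ReplacementBound {τ} {f} {c} 0≤τ 1+f≤τ Γ {u} {W} 0≤u τu<W with <-cmp 0ℚ u
... | tri> _ _ u<0  = contradiction (<-≤-trans u<0 0≤u) (<-irrefl refl)
... | tri≈ _ refl _ = begin
  (τ + 1ℚ) * W - (τ + τ) * 0ℚ
    ≡⟨ solve 2 (λ τ W → (τ :+ con 1ℚ) :* W :- (τ :+ τ) :* con 0ℚ := (τ :+ con 1ℚ) :* W) refl τ W ⟩
  (τ + 1ℚ) * W
    ≤⟨ *-monoʳ-≤-nonNeg W {{nonNegative 0≤W}} (GammaUpperBound⇒τ+1≤c {f = f} {c} 0≤τ 1+f≤τ Γ) ⟩
  c * W
    ≡⟨ solve 3 (λ c W f → c :* W := c :* (W :- (con 1ℚ :+ f) :* con 0ℚ)) refl c W f ⟩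
  c * (W - (1ℚ + f) * 0ℚ)
    ∎
  where
  0≤W : 0ℚ ≤ W
  0≤W = <⇒≤ (subst (_< W) (*-zeroʳ τ) τu<W)
... | tri< 0<u _ _  = begin
  (τ + 1ℚ) * W - (τ + τ) * u
    ≡⟨ cong (λ z → (τ + 1ℚ) * z - (τ + τ) * u) (sym u*x≡W) ⟩
  (τ + 1ℚ) * (u * x) - (τ + τ) * u
    ≡⟨ solve 3 (λ τ u x → (τ :+ con 1ℚ) :* (u :* x) :- (τ :+ τ) :* u
                          := u :* ((τ :+ con 1ℚ) :* x :- (τ :+ τ))) refl τ u x ⟩
  u * ((τ + 1ℚ) * x - (τ + τ))
    ≤⟨ *-monoˡ-≤-nonNeg u {{nonNegative 0≤u}} (Γ x (<⇒≤ τ<x) (≤-<-trans 1+f≤τ τ<x)) ⟩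
  u * (c * (x - (1ℚ + f)))
    ≡⟨ solve 4 (λ u c x f → u :* (c :* (x :- (con 1ℚ :+ f)))
                            := c :* (u :* x :- (con 1ℚ :+ f) :* u)) refl u c x f ⟩
  c * (u * x - (1ℚ + f) * u)
    ≡⟨ cong (λ z → c * (z - (1ℚ + f) * u)) u*x≡W ⟩
  c * (W - (1ℚ + f) * u)
    ∎
  where
  instance
    u-pos : Positive u
    u-pos = positive 0<u
    u-nonZero : NonZero u
    u-nonZero = pos⇒nonZero u
  x = W * 1/ u
  u*x≡W : u * x ≡ W
  u*x≡W = begin-equality
    u * (W * 1/ u)  ≡⟨ solve 3 (λ u W i → u :* (W :* i) := W :* (u :* i)) refl u W (1/ u) ⟩
    W * (u * 1/ u)  ≡⟨ cong (W *_) (*-inverseʳ u) ⟩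
    W * 1ℚ          ≡⟨ *-identityʳ W ⟩
    W               ∎
  τ<x : τ < x
  τ<x = *-cancelˡ-<-nonNeg u {{nonNegative 0≤u}} (subst₂ _<_ (*-comm τ u) (sym u*x≡W) τu<W)

NonNegState : ∀ {n} → State n → Set
NonNegState s = ∀ j → 0ℚ ≤ lw s j

module _ {τ f : ℚ} (1≤τ : 1ℚ ≤ τ) where

  step-mono : ∀ {n} {s s′ : State n} {w} → NonNegState s → Step τ f s w s′ →
              ∀ j → lw s j ≤ lw s′ j
  step-mono _  (leave _) j = ≤-refl
  step-mono {s = s} 0≤lw (match j _ τu<W _ lw′j≡W others _) k with k ≟ j
  ... | yes refl = subst (lw s j ≤_) (sym lw′j≡W) (<⇒≤ (≤-<-trans u≤τu τu<W))
    where
    u≤τu : lw s j ≤ τ * lw s j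
    u≤τu = subst (_≤ τ * lw s j) (*-identityˡ (lw s j))
                 (*-monoʳ-≤-nonNeg (lw s j) {{nonNegative (0≤lw j)}} 1≤τ)
  ... | no k≢j   = ≤-reflexive (sym (others k k≢j))

  step-nonNeg : ∀ {n} {s s′ : State n} {w} → NonNegState s → Step τ f s w s′ → NonNegState s′
  step-nonNeg 0≤lw stp j = ≤-trans (0≤lw j) (step-mono 0≤lw stp j)

  run-mono : ∀ {n} {s s′ : State n} {ws} → NonNegState s → Run τ f s ws s′ →
             ∀ j → lw s j ≤ lw s′ j
  run-mono _    done           j = ≤-refl
  run-mono 0≤lw (step stp run) j =
    ≤-trans (step-mono 0≤lw stp j) (run-mono (step-nonNeg 0≤lw stp) run j)

idle-budget : ∀ τ c L P → 0ℚ + τ * (L - L) ≤ c * (P - P)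
idle-budget τ c L P = ≤-reflexive
  (solve 4 (λ τ c L P → con 0ℚ :+ τ :* (L :- L) := c :* (P :- P)) refl τ c L P)

step-dual : ∀ {τ f c n} {s s′ : State n} {w} → ReplacementBound τ f c →
  NonNegState s → Step τ f s w s′ →
  Σ[ α ∈ ℚ ] 0ℚ ≤ α × (∀ j → w j ≤ α + τ * lw s j)
           × α + τ * (sumFin (lw s′) - sumFin (lw s)) ≤ c * (profit s′ - profit s)
step-dual {τ} {c = c} {s = s} {w = w} _ _ (leave w≤τlw) =
  0ℚ , ≤-refl , (λ j → subst (w j ≤_) (sym (+-identityˡ _)) (w≤τlw j))
     , idle-budget τ c (sumFin (lw s)) (profit s)
step-dual {τ} {f} {c} {s = s} {s′} {w} replace 0≤lw (match j _ τu<W greedy lw′j≡W others cost≡) =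
  W - τ * u , <⇒≤ (p<q⇒0<q-p τu<W) , covers , budget
  where
  u = lw s j
  W = w j
  L = sumFin (lw s)
  covers : ∀ k → w k ≤ (W - τ * u) + τ * lw s k
  covers k = begin
    w k                              ≡⟨ solve 2 (λ a b → a := (a :- b) :+ b) refl (w k) (τ * lw s k) ⟩
    (w k - τ * lw s k) + τ * lw s k  ≤⟨ +-monoˡ-≤ (τ * lw s k) (greedy k) ⟩
    (W - τ * u) + τ * lw s k         ∎
  L′≡ : sumFin (lw s′) ≡ L + (W - u)
  L′≡ = trans (sumFin-update (lw s) (lw s′) j others) (cong (λ z → L + (z - u)) lw′j≡W)
  budget : (W - τ * u) + τ * (sumFin (lw s′) - L) ≤ c * (profit s′ - profit s)
  budget = begin
    (W - τ * u) + τ * (sumFin (lw s′) - L)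
      ≡⟨ cong (λ z → (W - τ * u) + τ * (z - L)) L′≡ ⟩
    (W - τ * u) + τ * ((L + (W - u)) - L)
      ≡⟨ solve 4 (λ W τ u L → (W :- τ :* u) :+ τ :* ((L :+ (W :- u)) :- L)
                              := (τ :+ con 1ℚ) :* W :- (τ :+ τ) :* u) refl W τ u L ⟩
    (τ + 1ℚ) * W - (τ + τ) * u
      ≤⟨ replace (0≤lw j) τu<W ⟩
    c * (W - (1ℚ + f) * u)
      ≡⟨ solve 6 (λ c W f u L C → c :* (W :- (con 1ℚ :+ f) :* u)
                                  := c :* ((L :+ (W :- u)) :- (C :+ f :* u) :- (L :- C)))
                 refl c W f u L (cost s) ⟩
    c * ((L + (W - u)) - (cost s + f * u) - (L - cost s))
      ≡⟨ cong₂ (λ L′ C′ → c * (L′ - C′ - (L - cost s))) (sym L′≡) (sym cost≡) ⟩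
    c * (profit s′ - profit s)
      ∎

record DualFit {n} (τ c : ℚ) (s : State n) (ws : List (Arrival n)) (s′ : State n) : Set where
  field
    α        : Fin (length ws) → ℚ
    α-nonNeg : ∀ i → 0ℚ ≤ α i
    covers   : ∀ i j → lookup ws i j ≤ α i + τ * lw s′ j
    budget   : sumFin α + τ * (sumFin (lw s′) - sumFin (lw s)) ≤ c * (profit s′ - profit s)

run-dual : ∀ {τ f c n} {s s′ : State n} {ws} → 1ℚ ≤ τ → ReplacementBound τ f c →
           NonNegState s → Run τ f s ws s′ → DualFit τ c s ws s′
run-dual {τ} {c = c} {s = s} _ _ _ done = record
  { α = λ () ; α-nonNeg = λ () ; covers = λ ()
  ; budget = idle-budget τ c (sumFin (lw s)) (profit s) }
run-dual {τ} {f} {c} {s = s} {s″} 1≤τ replace 0≤lw (step {s' = s′} stp run)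
  with step-dual {c = c} replace 0≤lw stp
     | run-dual {c = c} 1≤τ replace (step-nonNeg 1≤τ 0≤lw stp) run
... | α₀ , 0≤α₀ , covers₀ , budget₀ | rest = record
  { α        = α₀ Vector.∷ α
  ; α-nonNeg = λ { zero → 0≤α₀ ; (suc i) → α-nonNeg i }
  ; covers   = λ { zero j    → ≤-trans (covers₀ j) (+-monoʳ-≤ α₀ (τ*-mono (lw-mono j)))
                 ; (suc i) j → covers i j }
  ; budget   = begin
      (α₀ + sumFin α) + τ * (L″ - L)
        ≡⟨ solve 6 (λ a A τ L L′ L″ → (a :+ A) :+ τ :* (L″ :- L)
                                      := (a :+ τ :* (L′ :- L)) :+ (A :+ τ :* (L″ :- L′)))
                   refl α₀ (sumFin α) τ L L′ L″ ⟩
      (α₀ + τ * (L′ - L)) + (sumFin α + τ * (L″ - L′))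
        ≤⟨ +-mono-≤ budget₀ budget ⟩
      c * (profit s′ - profit s) + c * (profit s″ - profit s′)
        ≡⟨ solve 4 (λ c P P′ P″ → c :* (P′ :- P) :+ c :* (P″ :- P′) := c :* (P″ :- P))
                   refl c (profit s) (profit s′) (profit s″) ⟩
      c * (profit s″ - profit s)
        ∎
  }
  where
  open DualFit rest
  L  = sumFin (lw s)
  L′ = sumFin (lw s′)
  L″ = sumFin (lw s″)
  lw-mono : ∀ j → lw s j ≤ lw s″ j
  lw-mono = run-mono 1≤τ 0≤lw (step stp run)
  τ*-mono : ∀ {p q} → p ≤ q → τ * p ≤ τ * q
  τ*-mono = *-monoˡ-≤-nonNeg τ {{nonNegative (≤-trans (<⇒≤ (positive⁻¹ 1ℚ)) 1≤τ)}}

DualFit-initState : ∀ {τ c n} {ws : List (Arrival n)} {s} (fit : DualFit τ c (initState n) ws s) →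
                    sumFin (DualFit.α fit) + τ * sumFin (lw s) ≤ c * profit s
DualFit-initState {τ} {c} {n} {s = s} fit = begin
  sumFin α + τ * sumFin (lw s)
    ≡⟨ cong (λ L → sumFin α + τ * L) (sym (+-identityʳ (sumFin (lw s)))) ⟩
  sumFin α + τ * (sumFin (lw s) - 0ℚ)
    ≡⟨ cong (λ L₀ → sumFin α + τ * (sumFin (lw s) - L₀)) (sym (sumFin-zero n)) ⟩
  sumFin α + τ * (sumFin (lw s) - sumFin (lw (initState n)))
    ≤⟨ budget ⟩
  c * (profit s - profit (initState n))
    ≡⟨ cong (λ L₀ → c * (profit s - (L₀ - 0ℚ))) (sumFin-zero n) ⟩
  c * (profit s - 0ℚ)
    ≡⟨ cong (c *_) (+-identityʳ (profit s)) ⟩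
  c * profit s
    ∎
  where open DualFit fit

theorem3 : (f τ : ℚ) → 0ℚ ≤ f → 1ℚ + f ≤ τ →
    (c : ℚ) → GammaUpperBound τ f c →
    (n : ℕ) (ws : List (Arrival n)) → NonNegWeights ws →
    (s : State n) → Run τ f (initState n) ws s →
    (M : Matching ws) → matchingWeight M ≤ c * profit s
theorem3 f τ 0≤f 1+f≤τ c Γ n ws _ s run M = begin
  matchingWeight M
    ≤⟨ matchingWeight-≤-dual M α (λ j → τ * lw s j) α-nonNeg 0≤τlw covers ⟩
  sumFin α + sumFin (λ j → τ * lw s j)
    ≡⟨ cong (sumFin α +_) (sumFin-distribˡ-* τ (lw s)) ⟩
  sumFin α + τ * sumFin (lw s)
    ≤⟨ DualFit-initState fit ⟩
  c * profit s
    ∎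
  where
  1≤τ : 1ℚ ≤ τ
  1≤τ = ≤-trans (p≤p+q 0≤f) 1+f≤τ
  0≤τ : 0ℚ ≤ τ
  0≤τ = ≤-trans (<⇒≤ (positive⁻¹ 1ℚ)) 1≤τ
  0≤lw₀ : NonNegState (initState n)
  0≤lw₀ _ = ≤-refl
  fit : DualFit τ c (initState n) ws s
  fit = run-dual 1≤τ (GammaUpperBound⇒ReplacementBound {τ} {f} {c} 0≤τ 1+f≤τ Γ) 0≤lw₀ run
  open DualFit fit
  0≤τlw : ∀ j → 0ℚ ≤ τ * lw s j
  0≤τlw j = 0≤p*q 0≤τ (≤-trans (0≤lw₀ j) (run-mono 1≤τ 0≤lw₀ run j))
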